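{- Let $G=(V,E)$ be a graph on $N$ vertices which is $N/8$-dense in $K_N$, whose edges are coloured with three colours in such a way that no monochromatic component contains a matching saturating at least $N/2$ vertices, and every monochromatic component has fewer than $3N/4$ vertices. Then for every pair of monochromatic components $F_1=(V_1,E_1)$ of the first colour and $F_2=(V_2,E_2)$ of the second colour with $|V_1|,|V_2|\ge N/2$, there exists a monochromatic component $F_3=(V_3,E_3)$ of the third colour such that $V=V_1\cup V_2\cup V_3$.
   Context: A graph $G$ on $N$ vertices is $b$-dense in $K_N$ if for every vertex $v$, $(N-1)-\deg_G(v)<b$. A monochromatic component of colour $i$ is a connected component of the spanning subgraph formed by the edges of colour $i$; a matching in it uses edges of colour $i$ of that component. A matching saturates $k$ vertices if it covers $k$ vertices. -}

module Defs where

open import Data.Nat using (ℕ; _+_; _*_; _∸_; _<_; _≤_)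
open import Data.Fin using (Fin)
open import Data.Fin.Subset using (Subset; _∈_; ∣_∣)
open import Data.Maybe using (Maybe; just; nothing; is-just)
open import Data.Bool using (if_then_else_)
open import Data.List using (List; []; _∷_; map; length; allFin; concatMap)
open import Data.Nat.ListAction using (sum)
open import Data.List.Relation.Unary.All using (All)
open import Data.List.Relation.Unary.Unique.Propositional using (Unique)
open import Data.Product using (Σ; _×_; _,_; proj₁; proj₂)
open import Relation.Binary.PropositionalEquality using (_≡_)
open import Relation.Binary.Construct.Closure.ReflexiveTransitive using (Star)
open import Function.Bundles using (_⇔_)

-- A 3-edge-coloured graph on vertex set Fin N:
-- c u v ≡ nothing   means uv is not an edge of G,
-- c u v ≡ just i    means uv is an edge of G of colour i.
Colouring : ℕ → Set
Colouring N = Fin N → Fin N → Maybe (Fin 3)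

IsSimple : {N : ℕ} → Colouring N → Set
IsSimple {N} c = (∀ (u v : Fin N) → c u v ≡ c v u) × (∀ (v : Fin N) → c v v ≡ nothing)

deg : {N : ℕ} → Colouring N → Fin N → ℕ
deg {N} c v = sum (map (λ u → if is-just (c v u) then 1 else 0) (allFin N))

-- G is (N/8)-dense in K_N:  (N-1) - deg v < N/8, i.e. 8 * ((N-1) - deg v) < N
DenseN/8 : {N : ℕ} → Colouring N → Set
DenseN/8 {N} c = ∀ (v : Fin N) → 8 * ((N ∸ 1) ∸ deg c v) < N

Adj : {N : ℕ} → Colouring N → Fin 3 → Fin N → Fin N → Set
Adj c i u v = c u v ≡ just i

Conn : {N : ℕ} → Colouring N → Fin 3 → Fin N → Fin N → Set
Conn c i = Star (Adj c i)

IsComponent : {N : ℕ} → Colouring N → Fin 3 → Subset N → Set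
IsComponent {N} c i S =
  Σ (Fin N) (λ v → v ∈ S) × (∀ (u w : Fin N) → u ∈ S → (w ∈ S ⇔ Conn c i u w))

endpoints : {N : ℕ} → List (Fin N × Fin N) → List (Fin N)
endpoints = concatMap (λ e → proj₁ e ∷ proj₂ e ∷ [])

IsMatchingIn : {N : ℕ} → Colouring N → Fin 3 → Subset N → List (Fin N × Fin N) → Set
IsMatchingIn c i S M =
  All (λ e → Adj c i (proj₁ e) (proj₂ e) × proj₁ e ∈ S × proj₂ e ∈ S) M
  × Unique (endpoints M)

saturated : {N : ℕ} → List (Fin N × Fin N) → ℕ
saturated M = 2 * length M

-- Write A = V₁ ─ V₂, B = V₂ ─ V₁, C = V₁ ∩ V₂, and W for the vertices outside V₁ ∪ V₂.
-- An edge between A and B, or between W and C, leaves both V₁ and V₂, so it has the third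
-- colour. A vertex u has m(u) < N/8 non-neighbours, so u and v have a common neighbour in every
-- set avoiding them with more than m(u) + m(v) elements. If |C| ≤ m(u) + m(v) for some u, v,
-- then |C| < N/4 and |A|, |B| > N/4; then A ∪ B lies in one component of the third colour,
-- and adding edges one at a time (exchanging a matched edge when needed) builds a matching
-- between A and B of size min(|A|, |B|) > N/4 in it, saturating more than N/2 vertices.
-- Hence any two vertices of W have a common neighbour in C, and W lies in a single component
-- of the third colour.

module Submission where

open import Defs
open import Data.Bool using (Bool; true; false; T; if_then_else_)
open import Data.Bool.Properties using (T-≡)
open import Data.Empty using (⊥; ⊥-elim)
open import Data.Fin using (Fin; zero; suc; _≟_)
open import Data.Fin.Properties using (any?; 0≢1+n; suc-injective)
open import Data.Fin.Subset
  using (Subset; inside; outside; ⁅_⁆; _∈_; _∉_; _⊆_; _⊂_; _∩_; _∪_; _─_; ∁; ∣_∣; Nonempty; Empty)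
  renaming (⊥ to ∅)
open import Data.Fin.Subset.Properties
  using ( _∈?_; _⊂?_; nonempty?; Empty-unique; ∣⊥∣≡0; ∣p∣≤n; ∣⁅x⁆∣≡1; x∈⁅x⁆; x∈⁅y⁆⇒x≡y; ∉⊥
        ; p⊆q⇒∣p∣≤∣q∣; p⊂q⇒∣p∣<∣q∣; x∈p∩q⁺; x∈p∩q⁻; p∩q⊆q; ∣p∩q∣≤∣q∣; ∩-distribˡ-∪; ∩-comm
        ; x∈p∪q⁺; x∈p∪q⁻; p⊆p∪q; x∈p∧x∉q⇒x∈p─q; x∉p⇒x∈∁p; x∈∁p⇒x∉p; ∣∁p∣≡n∸∣p∣ )
open import Data.List using (List; []; _∷_)
import Data.List as List
open import Data.List.Properties using (map-tabulate; length-tabulate)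
open import Data.List.Relation.Unary.All using (All; []; _∷_)
open import Data.List.Relation.Unary.All.Properties using (tabulate⁺)
open import Data.List.Relation.Unary.AllPairs using ([]; _∷_)
open import Data.List.Relation.Unary.Unique.Propositional using (Unique)
open import Data.Maybe using (just; nothing; is-just)
open import Data.Maybe.Properties using (≡-dec)
open import Data.Nat using (ℕ; zero; suc; _+_; _*_; _∸_; _⊓_; _<_; _≤_; _<?_; pred; z≤n; s≤s)
open import Data.Nat.ListAction using (sum)
open import Data.Nat.Properties
  using ( ≤-trans; ≤-reflexive; <-≤-trans; ≤-<-trans; <-trans; <-irrefl; <-asym; <⇒≤; ≮⇒≥; <⇒≤pred
        ; +-identityʳ; +-assoc; +-comm; +-suc; +-mono-≤; +-monoˡ-≤; +-monoʳ-≤; +-monoˡ-<; +-monoʳ-<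
        ; +-cancelˡ-<; +-cancelʳ-<; *-assoc; *-monoʳ-≤; *-cancelˡ-≤; *-cancelˡ-<; m≤n+m; >⇒≢
        ; pred[m∸n]≡m∸[1+n]; ∸-+-assoc; m⊓n≤m; m⊓n≤n; ⊓-glb; *-distribˡ-⊓; module ≤-Reasoning )
open import Data.Nat.Tactic.RingSolver using (solve-∀)
open import Data.Product using (Σ; ∃; _×_; _,_; proj₁; proj₂)
open import Data.Sum using (_⊎_; inj₁; inj₂; [_,_])
open import Data.Vec using (_∷_; []; lookup; tabulate; here; there)
open import Data.Vec.Properties using (lookup∘tabulate; []=⇒lookup; lookup⇒[]=)
open import Data.Vec.Functional using (Vector; updateAt) renaming (_∷_ to _◂_)
open import Data.Vec.Functional.Properties using (updateAt-updates; updateAt-minimal)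
open import Function using (_∘_; const; _⇔_; mk⇔; Equivalence)
open import Function.Definitions using (Injective)
open import Level using (Level)
open import Relation.Binary using (Rel; Decidable)
open import Relation.Binary.Construct.Closure.ReflexiveTransitive using (Star; ε; _◅_; _◅◅_; reverse)
open import Relation.Binary.PropositionalEquality using (_≡_; _≢_; refl; sym; trans; cong; subst)
open import Relation.Nullary using (¬_; yes; no; contradiction)
open import Relation.Nullary.Decidable using (⌊_⌋; _×-dec_; toWitness; fromWitness)

open Equivalence using (to; from)

private
  variable
    m n N : ℕ

-- Finite subsets

∈⇔lookup : {p : Subset n} {x : Fin n} → x ∈ p ⇔ T (lookup p x)
∈⇔lookup {p = p} {x} = mk⇔ (from T-≡ ∘ []=⇒lookup) (lookup⇒[]= x p ∘ to T-≡)

∈-tabulate : {f : Fin n → Bool} {x : Fin n} → x ∈ tabulate f ⇔ T (f x)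
∈-tabulate {f = f} {x} = mk⇔ (subst T (lookup∘tabulate f x) ∘ to ∈⇔lookup)
                             (from ∈⇔lookup ∘ subst T (sym (lookup∘tabulate f x)))

x∈p─q⁻ : ∀ {x : Fin n} (p q : Subset n) → x ∈ p ─ q → x ∈ p × x ∉ q
x∈p─q⁻ (inside ∷ p) (outside ∷ q) here = here , λ ()
x∈p─q⁻ (_ ∷ p) (inside ∷ q) (there x∈) with x∈p─q⁻ p q x∈
... | x∈p , x∉q = there x∈p , λ { (there x∈q) → x∉q x∈q }
x∈p─q⁻ (_ ∷ p) (outside ∷ q) (there x∈) with x∈p─q⁻ p q x∈
... | x∈p , x∉q = there x∈p , λ { (there x∈q) → x∉q x∈q }

x∈[p─q]∩r⁻ : ∀ {x : Fin n} (p q r : Subset n) → x ∈ (p ─ q) ∩ r → x ∈ p × x ∉ q × x ∈ r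
x∈[p─q]∩r⁻ p q r x∈ with x∈p∩q⁻ (p ─ q) r x∈
... | x∈p─q , x∈r with x∈p─q⁻ p q x∈p─q
...   | x∈p , x∉q = x∈p , x∉q , x∈r

Empty[[p─q]∩r]⇒p∩r⊆q : ∀ (p q r : Subset n) → Empty ((p ─ q) ∩ r) → p ∩ r ⊆ q
Empty[[p─q]∩r]⇒p∩r⊆q p q r empty {x} x∈p∩r with x ∈? q
... | yes x∈q = x∈q
... | no  x∉q with x∈p∩q⁻ p r x∈p∩r
...   | x∈p , x∈r = contradiction (x , x∈p∩q⁺ (x∈p∧x∉q⇒x∈p─q x∈p x∉q , x∈r)) empty

∣p∣≡∣p∩q∣+∣p─q∣ : ∀ (p q : Subset n) → ∣ p ∣ ≡ ∣ p ∩ q ∣ + ∣ p ─ q ∣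
∣p∣≡∣p∩q∣+∣p─q∣ [] [] = refl
∣p∣≡∣p∩q∣+∣p─q∣ (inside  ∷ p) (inside  ∷ q) = cong suc (∣p∣≡∣p∩q∣+∣p─q∣ p q)
∣p∣≡∣p∩q∣+∣p─q∣ (inside  ∷ p) (outside ∷ q) =
  trans (cong suc (∣p∣≡∣p∩q∣+∣p─q∣ p q)) (sym (+-suc ∣ p ∩ q ∣ ∣ p ─ q ∣))
∣p∣≡∣p∩q∣+∣p─q∣ (outside ∷ p) (inside  ∷ q) = ∣p∣≡∣p∩q∣+∣p─q∣ p q
∣p∣≡∣p∩q∣+∣p─q∣ (outside ∷ p) (outside ∷ q) = ∣p∣≡∣p∩q∣+∣p─q∣ p q

∣p∩q∣+∣p∪q∣≡∣p∣+∣q∣ : ∀ (p q : Subset n) → ∣ p ∩ q ∣ + ∣ p ∪ q ∣ ≡ ∣ p ∣ + ∣ q ∣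
∣p∩q∣+∣p∪q∣≡∣p∣+∣q∣ [] [] = refl
∣p∩q∣+∣p∪q∣≡∣p∣+∣q∣ (inside  ∷ p) (inside  ∷ q) =
  cong suc (trans (+-suc _ _) (trans (cong suc (∣p∩q∣+∣p∪q∣≡∣p∣+∣q∣ p q)) (sym (+-suc _ _))))
∣p∩q∣+∣p∪q∣≡∣p∣+∣q∣ (inside  ∷ p) (outside ∷ q) =
  trans (+-suc _ _) (cong suc (∣p∩q∣+∣p∪q∣≡∣p∣+∣q∣ p q))
∣p∩q∣+∣p∪q∣≡∣p∣+∣q∣ (outside ∷ p) (inside  ∷ q) =
  trans (+-suc _ _) (trans (cong suc (∣p∩q∣+∣p∪q∣≡∣p∣+∣q∣ p q)) (sym (+-suc _ _)))
∣p∩q∣+∣p∪q∣≡∣p∣+∣q∣ (outside ∷ p) (outside ∷ q) = ∣p∩q∣+∣p∪q∣≡∣p∣+∣q∣ p q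

∣p∪q∣≤∣p∣+∣q∣ : ∀ (p q : Subset n) → ∣ p ∪ q ∣ ≤ ∣ p ∣ + ∣ q ∣
∣p∪q∣≤∣p∣+∣q∣ p q = ≤-trans (m≤n+m ∣ p ∪ q ∣ ∣ p ∩ q ∣) (≤-reflexive (∣p∩q∣+∣p∪q∣≡∣p∣+∣q∣ p q))

Empty⇒∣p∣≡0 : {p : Subset n} → Empty p → ∣ p ∣ ≡ 0
Empty⇒∣p∣≡0 {n} empty = trans (cong ∣_∣ (Empty-unique empty)) (∣⊥∣≡0 n)

∣p∣>0⇒Nonempty : (p : Subset n) → 0 < ∣ p ∣ → Nonempty p
∣p∣>0⇒Nonempty p 0<∣p∣ with nonempty? p
... | yes nonempty = nonempty
... | no  empty    = contradiction (Empty⇒∣p∣≡0 empty) (>⇒≢ 0<∣p∣)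

n<∣p∣+∣q∣⇒Nonempty[p∩q] : (p q : Subset n) → n < ∣ p ∣ + ∣ q ∣ → Nonempty (p ∩ q)
n<∣p∣+∣q∣⇒Nonempty[p∩q] {n} p q n<∣p∣+∣q∣ = ∣p∣>0⇒Nonempty (p ∩ q)
  (+-cancelʳ-< n 0 ∣ p ∩ q ∣ (begin-strict
    n                          <⟨ n<∣p∣+∣q∣ ⟩
    ∣ p ∣ + ∣ q ∣             ≡⟨ sym (∣p∩q∣+∣p∪q∣≡∣p∣+∣q∣ p q) ⟩
    ∣ p ∩ q ∣ + ∣ p ∪ q ∣     ≤⟨ +-monoʳ-≤ ∣ p ∩ q ∣ (∣p∣≤n (p ∪ q)) ⟩
    ∣ p ∩ q ∣ + n             ∎))
  where open ≤-Reasoning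

image : (Fin m → Fin n) → Subset n
image {zero}  f = ∅
image {suc m} f = ⁅ f zero ⁆ ∪ image (f ∘ suc)

preimage : (Fin m → Fin n) → Subset n → Subset m
preimage f q = tabulate (lookup q ∘ f)

∈image⁺ : ∀ (f : Fin m → Fin n) i → f i ∈ image f
∈image⁺ f zero    = x∈p∪q⁺ (inj₁ (x∈⁅x⁆ (f zero)))
∈image⁺ f (suc i) = x∈p∪q⁺ (inj₂ (∈image⁺ (f ∘ suc) i))

∈image⁻ : ∀ (f : Fin m → Fin n) {x} → x ∈ image f → ∃ λ i → f i ≡ x
∈image⁻ {zero}  f x∈ = ⊥-elim (∉⊥ x∈)
∈image⁻ {suc m} f x∈ with x∈p∪q⁻ ⁅ f zero ⁆ (image (f ∘ suc)) x∈
... | inj₁ x∈⁅f0⁆ = zero , sym (x∈⁅y⁆⇒x≡y (f zero) x∈⁅f0⁆)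
... | inj₂ x∈rest with ∈image⁻ (f ∘ suc) x∈rest
...   | i , fi≡x = suc i , fi≡x

∈preimage : ∀ {f : Fin m → Fin n} {q i} → i ∈ preimage f q ⇔ f i ∈ q
∈preimage = mk⇔ (from ∈⇔lookup ∘ to ∈-tabulate) (from ∈-tabulate ∘ to ∈⇔lookup)

preimage-mono : ∀ (f : Fin m → Fin n) {p q} → p ⊆ q → preimage f p ⊆ preimage f q
preimage-mono f p⊆q = from ∈preimage ∘ p⊆q ∘ to ∈preimage

∣p∩⁅x⁆∣+∣r∣≤∣p[x]∷r∣ : ∀ (p : Subset n) x (r : Subset m) → ∣ p ∩ ⁅ x ⁆ ∣ + ∣ r ∣ ≤ ∣ lookup p x ∷ r ∣
∣p∩⁅x⁆∣+∣r∣≤∣p[x]∷r∣ p x r with lookup p x in p[x]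
... | true  = +-monoˡ-≤ ∣ r ∣ (≤-trans (∣p∩q∣≤∣q∣ p ⁅ x ⁆) (≤-reflexive (∣⁅x⁆∣≡1 x)))
... | false = ≤-reflexive (cong (_+ ∣ r ∣) (Empty⇒∣p∣≡0 p∩⁅x⁆-empty))
  where
  p∩⁅x⁆-empty : Empty (p ∩ ⁅ x ⁆)
  p∩⁅x⁆-empty (y , y∈) with x∈p∩q⁻ p ⁅ x ⁆ y∈
  ... | y∈p , y∈⁅x⁆ rewrite x∈⁅y⁆⇒x≡y x y∈⁅x⁆ = subst T p[x] (to ∈⇔lookup y∈p)

∣q∩image∣≤∣preimage∣ : ∀ (f : Fin m → Fin n) q → ∣ q ∩ image f ∣ ≤ ∣ preimage f q ∣
∣q∩image∣≤∣preimage∣ {zero}  {n} f q = ≤-trans (∣p∩q∣≤∣q∣ q (image f)) (≤-reflexive (∣⊥∣≡0 n))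
∣q∩image∣≤∣preimage∣ {suc m}     f q = begin
  ∣ q ∩ (⁅ x ⁆ ∪ rest) ∣                    ≡⟨ cong ∣_∣ (∩-distribˡ-∪ q ⁅ x ⁆ rest) ⟩
  ∣ q ∩ ⁅ x ⁆ ∪ q ∩ rest ∣                  ≤⟨ ∣p∪q∣≤∣p∣+∣q∣ (q ∩ ⁅ x ⁆) (q ∩ rest) ⟩
  ∣ q ∩ ⁅ x ⁆ ∣ + ∣ q ∩ rest ∣              ≤⟨ +-monoʳ-≤ ∣ q ∩ ⁅ x ⁆ ∣ (∣q∩image∣≤∣preimage∣ (f ∘ suc) q) ⟩
  ∣ q ∩ ⁅ x ⁆ ∣ + ∣ preimage (f ∘ suc) q ∣  ≤⟨ ∣p∩⁅x⁆∣+∣r∣≤∣p[x]∷r∣ q x (preimage (f ∘ suc) q) ⟩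
  ∣ preimage f q ∣                          ∎
  where
  open ≤-Reasoning
  x = f zero
  rest = image (f ∘ suc)

⊆image⇒∣p∣≤∣preimage∣ : ∀ (f : Fin m → Fin n) {p} → p ⊆ image f → ∣ p ∣ ≤ ∣ preimage f p ∣
⊆image⇒∣p∣≤∣preimage∣ f {p} p⊆image =
  ≤-trans (p⊆q⇒∣p∣≤∣q∣ (λ x∈p → x∈p∩q⁺ (x∈p , p⊆image x∈p))) (∣q∩image∣≤∣preimage∣ f p)

m<∣p∣⇒∃∉image : ∀ (f : Fin m → Fin n) p → m < ∣ p ∣ → ∃ λ x → x ∈ p × x ∉ image f
m<∣p∣⇒∃∉image {m} f p m<∣p∣ with ∣p∣>0⇒Nonempty (p ─ image f) 0<∣p─image∣
  where
  open ≤-Reasoning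
  0<∣p─image∣ : 0 < ∣ p ─ image f ∣
  0<∣p─image∣ = +-cancelˡ-< m 0 ∣ p ─ image f ∣ (begin-strict
    m + 0                              ≡⟨ +-identityʳ m ⟩
    m                                  <⟨ m<∣p∣ ⟩
    ∣ p ∣                              ≡⟨ ∣p∣≡∣p∩q∣+∣p─q∣ p (image f) ⟩
    ∣ p ∩ image f ∣ + ∣ p ─ image f ∣  ≤⟨ +-monoˡ-≤ _ (≤-trans (∣q∩image∣≤∣preimage∣ f p) (∣p∣≤n (preimage f p))) ⟩
    m + ∣ p ─ image f ∣                ∎)
... | x , x∈ = x , x∈p─q⁻ p (image f) x∈

-- Reachability in a decidable relation on a finite set

module Reachability {ℓ : Level} {R : Rel (Fin n) ℓ} (R? : Decidable R) where

  successors : Subset n → Subset n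
  successors p = tabulate (λ y → ⌊ any? (λ x → x ∈? p ×-dec R? x y) ⌋)

  ∈successors : ∀ {p y} → y ∈ successors p ⇔ ∃ λ x → x ∈ p × R x y
  ∈successors = mk⇔ (toWitness ∘ to ∈-tabulate) (from ∈-tabulate ∘ fromWitness)

  grow : Subset n → Subset n
  grow p = p ∪ successors p

  p⊆grow[p] : ∀ p → p ⊆ grow p
  p⊆grow[p] p = p⊆p∪q (successors p)

  grow-mono : ∀ {p q} → p ⊆ q → grow p ⊆ grow q
  grow-mono {p} {q} p⊆q y∈ with x∈p∪q⁻ p (successors p) y∈
  ... | inj₁ y∈p = p⊆grow[p] q (p⊆q y∈p)
  ... | inj₂ y∈s with to ∈successors y∈s
  ...   | x , x∈p , Rxy = x∈p∪q⁺ (inj₂ (from ∈successors (x , p⊆q x∈p , Rxy)))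

  Closed : Subset n → Set
  Closed p = grow p ⊆ p

  closed-or-grows : ∀ p → Closed p ⊎ ∣ p ∣ < ∣ grow p ∣
  closed-or-grows p with p ⊂? grow p
  ... | yes p⊂grow = inj₂ (p⊂q⇒∣p∣<∣q∣ p⊂grow)
  ... | no  p⊄grow = inj₁ grow⊆p
    where
    grow⊆p : grow p ⊆ p
    grow⊆p {y} y∈ with y ∈? p
    ... | yes y∈p = y∈p
    ... | no  y∉p = contradiction ((λ {x} → p⊆grow[p] p {x}) , y , y∈ , y∉p) p⊄grow

  Closed⇒Star-closed : ∀ {q x y} → Closed q → x ∈ q → Star R x y → y ∈ q
  Closed⇒Star-closed closed x∈q ε            = x∈q
  Closed⇒Star-closed closed x∈q (Rxz ◅ path) =
    Closed⇒Star-closed closed (closed (x∈p∪q⁺ (inj₂ (from ∈successors (_ , x∈q , Rxz))))) path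

  ball : Fin n → ℕ → Subset n
  ball v zero    = ⁅ v ⁆
  ball v (suc k) = grow (ball v k)

  v∈ball : ∀ v k → v ∈ ball v k
  v∈ball v zero    = x∈⁅x⁆ v
  v∈ball v (suc k) = p⊆grow[p] (ball v k) (v∈ball v k)

  ∈ball⇒Star : ∀ {v x} k → x ∈ ball v k → Star R v x
  ∈ball⇒Star {v} zero x∈ rewrite x∈⁅y⁆⇒x≡y v x∈ = ε
  ∈ball⇒Star {v} (suc k) x∈ with x∈p∪q⁻ (ball v k) _ x∈
  ... | inj₁ x∈ball = ∈ball⇒Star k x∈ball
  ... | inj₂ x∈s with to ∈successors x∈s
  ...   | y , y∈ball , Ryx = ∈ball⇒Star k y∈ball ◅◅ (Ryx ◅ ε)

  ball-closed-or-large : ∀ v k → Closed (ball v k) ⊎ k < ∣ ball v k ∣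
  ball-closed-or-large v zero = inj₂ (≤-reflexive (sym (∣⁅x⁆∣≡1 v)))
  ball-closed-or-large v (suc k) with ball-closed-or-large v k
  ... | inj₁ closed = inj₁ (grow-mono closed)
  ... | inj₂ large with closed-or-grows (ball v k)
  ...   | inj₁ closed = inj₁ (grow-mono closed)
  ...   | inj₂ grows  = inj₂ (<-≤-trans (s≤s large) grows)

  reachable : Fin n → Subset n
  reachable v = ball v n

  reachable-closed : ∀ v → Closed (reachable v)
  reachable-closed v with ball-closed-or-large v n
  ... | inj₁ closed = closed
  ... | inj₂ large  = contradiction (<-≤-trans large (∣p∣≤n (ball v n))) (<-irrefl refl)

  ∈reachable : ∀ {v x} → x ∈ reachable v ⇔ Star R v x
  ∈reachable {v} = mk⇔ (∈ball⇒Star n) (Closed⇒Star-closed (reachable-closed v) (v∈ball v n))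

-- Neighbourhoods, non-neighbours and components

Nbr : Colouring N → Fin N → Subset N
Nbr c u = tabulate (λ v → is-just (c u v))

missing : Colouring N → Fin N → ℕ
missing {N} c u = (N ∸ 1) ∸ deg c u

sum-indicator≡∣tabulate∣ : (f : Fin n → Bool) →
  sum (List.tabulate (λ i → if f i then 1 else 0)) ≡ ∣ tabulate f ∣
sum-indicator≡∣tabulate∣ {zero}  f = refl
sum-indicator≡∣tabulate∣ {suc n} f with f zero
... | true  = cong suc (sum-indicator≡∣tabulate∣ (f ∘ suc))
... | false = sum-indicator≡∣tabulate∣ (f ∘ suc)

deg≡∣Nbr∣ : ∀ (c : Colouring N) u → deg c u ≡ ∣ Nbr c u ∣
deg≡∣Nbr∣ {N} c u =
  trans (cong sum (map-tabulate {n = N} (λ v → v) (λ v → if is-just (c u v) then 1 else 0)))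
        (sum-indicator≡∣tabulate∣ (λ v → is-just (c u v)))

Adj? : (c : Colouring N) (i : Fin 3) → Decidable (Adj c i)
Adj? c i u v = ≡-dec _≟_ (c u v) (just i)

third-colour : ∀ {c : Colouring N} {u w} → w ∈ Nbr c u
  → ¬ Adj c zero u w → ¬ Adj c (suc zero) u w → Adj c (suc (suc zero)) u w
third-colour {c = c} {u} {w} w∈ ¬adj₀ ¬adj₁ with c u w | to ∈-tabulate w∈
... | nothing               | ()
... | just zero             | _ = contradiction refl ¬adj₀
... | just (suc zero)       | _ = contradiction refl ¬adj₁
... | just (suc (suc zero)) | _ = refl

component-closed : ∀ {c : Colouring N} {i S u w} → IsComponent c i S → u ∈ S → Conn c i u w → w ∈ S
component-closed (_ , conn) u∈S = from (conn _ _ u∈S)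

Separates : Subset N → Fin N → Fin N → Set
Separates S u w = (u ∈ S × w ∉ S) ⊎ (u ∉ S × w ∈ S)

module _ {c : Colouring N} (simple : IsSimple c) where

  Nbr-sym : ∀ {u v} → v ∈ Nbr c u → u ∈ Nbr c v
  Nbr-sym {u} {v} v∈ = from ∈-tabulate (subst (T ∘ is-just) (proj₁ simple u v) (to ∈-tabulate v∈))

  u∉Nbr[u] : ∀ u → u ∉ Nbr c u
  u∉Nbr[u] u u∈ = subst (T ∘ is-just) (proj₂ simple u) (to ∈-tabulate u∈)

  Adj-sym : ∀ {i u v} → Adj c i u v → Adj c i v u
  Adj-sym {u = u} {v} adj = trans (proj₁ simple v u) adj

  ∣p∣≤∣p∩Nbr∣+missing : ∀ {u} p → u ∉ p → ∣ p ∣ ≤ ∣ p ∩ Nbr c u ∣ + missing c u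
  ∣p∣≤∣p∩Nbr∣+missing {u} p u∉p = begin
    ∣ p ∣                              ≡⟨ ∣p∣≡∣p∩q∣+∣p─q∣ p (Nbr c u) ⟩
    ∣ p ∩ Nbr c u ∣ + ∣ p ─ Nbr c u ∣  ≤⟨ +-monoʳ-≤ _ ∣p─Nbr∣≤missing ⟩
    ∣ p ∩ Nbr c u ∣ + missing c u      ∎
    where
    open ≤-Reasoning
    p─Nbr⊂∁Nbr : p ─ Nbr c u ⊂ ∁ (Nbr c u)
    p─Nbr⊂∁Nbr = (λ x∈ → x∉p⇒x∈∁p (proj₂ (x∈p─q⁻ p _ x∈)))
               , u , x∉p⇒x∈∁p (u∉Nbr[u] u) , (u∉p ∘ proj₁ ∘ x∈p─q⁻ p _)
    ∣p─Nbr∣≤missing : ∣ p ─ Nbr c u ∣ ≤ missing c u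
    ∣p─Nbr∣≤missing = begin
      ∣ p ─ Nbr c u ∣          ≤⟨ <⇒≤pred (p⊂q⇒∣p∣<∣q∣ p─Nbr⊂∁Nbr) ⟩
      pred ∣ ∁ (Nbr c u) ∣     ≡⟨ cong pred (∣∁p∣≡n∸∣p∣ (Nbr c u)) ⟩
      pred (N ∸ ∣ Nbr c u ∣)   ≡⟨ pred[m∸n]≡m∸[1+n] N _ ⟩
      N ∸ suc ∣ Nbr c u ∣      ≡⟨ sym (∸-+-assoc N 1 _) ⟩
      (N ∸ 1) ∸ ∣ Nbr c u ∣    ≡⟨ cong ((N ∸ 1) ∸_) (sym (deg≡∣Nbr∣ c u)) ⟩
      missing c u              ∎

  common-neighbour : ∀ {u v} p → u ∉ p → v ∉ p → missing c u + missing c v < ∣ p ∣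
    → ∃ λ z → z ∈ p × z ∈ Nbr c u × z ∈ Nbr c v
  common-neighbour {u} {v} p u∉p v∉p bound =
    split (∣p∣>0⇒Nonempty ((p ∩ Nbr c u) ∩ Nbr c v) (+-cancelʳ-< (mᵤ + mᵥ) 0 _ (begin-strict
      mᵤ + mᵥ                                  <⟨ bound ⟩
      ∣ p ∣                                    ≤⟨ ∣p∣≤∣p∩Nbr∣+missing p u∉p ⟩
      ∣ p ∩ Nbr c u ∣ + mᵤ                     ≤⟨ +-monoˡ-≤ mᵤ (∣p∣≤∣p∩Nbr∣+missing (p ∩ Nbr c u) v∉p∩Nbrᵤ) ⟩
      (∣ (p ∩ Nbr c u) ∩ Nbr c v ∣ + mᵥ) + mᵤ  ≡⟨ +-assoc _ mᵥ mᵤ ⟩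
      ∣ (p ∩ Nbr c u) ∩ Nbr c v ∣ + (mᵥ + mᵤ)  ≡⟨ cong (∣ (p ∩ Nbr c u) ∩ Nbr c v ∣ +_) (+-comm mᵥ mᵤ) ⟩
      ∣ (p ∩ Nbr c u) ∩ Nbr c v ∣ + (mᵤ + mᵥ)  ∎)))
    where
    open ≤-Reasoning
    mᵤ = missing c u
    mᵥ = missing c v
    v∉p∩Nbrᵤ : v ∉ p ∩ Nbr c u
    v∉p∩Nbrᵤ = v∉p ∘ proj₁ ∘ x∈p∩q⁻ p (Nbr c u)
    split : Nonempty ((p ∩ Nbr c u) ∩ Nbr c v) → ∃ λ z → z ∈ p × z ∈ Nbr c u × z ∈ Nbr c v
    split (z , z∈) with x∈p∩q⁻ (p ∩ Nbr c u) (Nbr c v) z∈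
    ... | z∈p∩Nbrᵤ , z∈Nbrᵥ = z , proj₁ (x∈p∩q⁻ p _ z∈p∩Nbrᵤ) , proj₂ (x∈p∩q⁻ p _ z∈p∩Nbrᵤ) , z∈Nbrᵥ

  component : ∀ i v → Σ (Subset N) λ S → IsComponent c i S × v ∈ S
  component i v = reachable v , ((v , v∈S) , λ u w u∈S → mk⇔ (connect u∈S) (extend u∈S)) , v∈S
    where
    open Reachability (Adj? c i)
    v∈S = from ∈reachable ε
    connect : ∀ {u w} → u ∈ reachable v → w ∈ reachable v → Conn c i u w
    connect u∈S w∈S = reverse Adj-sym (to ∈reachable u∈S) ◅◅ to ∈reachable w∈S
    extend : ∀ {u w} → u ∈ reachable v → Conn c i u w → w ∈ reachable v
    extend u∈S path = from ∈reachable (to ∈reachable u∈S ◅◅ path)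

  separated⇒¬Adj : ∀ {i S u w} → IsComponent c i S → Separates S u w → ¬ Adj c i u w
  separated⇒¬Adj comp (inj₁ (u∈S , w∉S)) adj = w∉S (component-closed comp u∈S (adj ◅ ε))
  separated⇒¬Adj comp (inj₂ (u∉S , w∈S)) adj = u∉S (component-closed comp w∈S (Adj-sym adj ◅ ε))

-- Matchings between two disjoint vertex sets

◂-injective : ∀ {x} {f : Fin m → Fin n} → x ∉ image f → Injective _≡_ _≡_ f → Injective _≡_ _≡_ (x ◂ f)
◂-injective         x∉ f-inj {zero}  {zero}  _     = refl
◂-injective {f = f} x∉ f-inj {zero}  {suc j} x≡fj  = ⊥-elim (x∉ (subst (_∈ image f) (sym x≡fj) (∈image⁺ f j)))
◂-injective {f = f} x∉ f-inj {suc i} {zero}  fi≡x  = ⊥-elim (x∉ (subst (_∈ image f) fi≡x (∈image⁺ f i)))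
◂-injective         x∉ f-inj {suc i} {suc j} fi≡fj = cong suc (f-inj fi≡fj)

updateAt-elim : ∀ {a} {A : Set a} (P : Fin m → A → Set) {f : Vector A m} {i y}
  → P i y → (∀ j → j ≢ i → P j (f j)) → ∀ j → P j (updateAt f i (const y) j)
updateAt-elim P {f} {i} Piy Pf j with j ≟ i
... | yes refl = subst (P i) (sym (updateAt-updates i f)) Piy
... | no j≢i   = subst (P j) (sym (updateAt-minimal j i f j≢i)) (Pf j j≢i)

module _ {f : Fin m → Fin n} (f-inj : Injective _≡_ _≡_ f) {y} (y∉ : y ∉ image f) (i : Fin m) where

  private
    f′ = updateAt f i (const y)

    f′-elsewhere : ∀ {j} → j ≢ i → f′ j ≡ f j
    f′-elsewhere j≢i = updateAt-minimal _ i f j≢i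

    f≢y : ∀ j → f j ≢ y
    f≢y j fj≡y = y∉ (subst (_∈ image f) fj≡y (∈image⁺ f j))

  updateAt-injective : Injective _≡_ _≡_ f′
  updateAt-injective {j} {k} f′j≡f′k with j ≟ i | k ≟ i
  ... | yes refl | yes refl = refl
  ... | yes refl | no k≢i   =
    contradiction (trans (sym (f′-elsewhere k≢i)) (trans (sym f′j≡f′k) (updateAt-updates i f))) (f≢y k)
  ... | no j≢i   | yes refl =
    contradiction (trans (sym (f′-elsewhere j≢i)) (trans f′j≡f′k (updateAt-updates i f))) (f≢y j)
  ... | no j≢i   | no k≢i   = f-inj (trans (sym (f′-elsewhere j≢i)) (trans f′j≡f′k (f′-elsewhere k≢i)))

  replaced∉image : f i ∉ image f′
  replaced∉image fi∈ with ∈image⁻ f′ fi∈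
  ... | j , f′j≡fi with j ≟ i
  ...   | yes refl = f≢y i (sym (trans (sym (updateAt-updates i f)) f′j≡fi))
  ...   | no j≢i   = j≢i (f-inj (trans (sym (f′-elsewhere j≢i)) f′j≡fi))

record Matching (c : Colouring N) (A B : Subset N) (s : ℕ) : Set where
  field
    left right      : Fin s → Fin N
    left∈A          : ∀ i → left i ∈ A
    right∈B         : ∀ i → right i ∈ B
    edge            : ∀ i → right i ∈ Nbr c (left i)
    left-injective  : Injective _≡_ _≡_ left
    right-injective : Injective _≡_ _≡_ right

open Matching

module _ {c : Colouring N} {A B : Subset N} where

  no-edges : Matching c A B 0
  no-edges = record
    { left = λ () ; right = λ () ; left∈A = λ () ; right∈B = λ () ; edge = λ ()
    ; left-injective = λ {} ; right-injective = λ {} }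

  add-edge : ∀ {s} (M : Matching c A B s) {a b} → a ∈ A → b ∈ B → b ∈ Nbr c a
    → a ∉ image (left M) → b ∉ image (right M) → Matching c A B (suc s)
  add-edge M {a} {b} a∈A b∈B a∼b a∉ b∉ = record
    { left            = a ◂ left M
    ; right           = b ◂ right M
    ; left∈A          = λ { zero → a∈A ; (suc i) → left∈A M i }
    ; right∈B         = λ { zero → b∈B ; (suc i) → right∈B M i }
    ; edge            = λ { zero → a∼b ; (suc i) → edge M i }
    ; left-injective  = ◂-injective a∉ (left-injective M)
    ; right-injective = ◂-injective b∉ (right-injective M)
    }

  redirect : ∀ {s} (M : Matching c A B s) (i : Fin s) {b} → b ∈ B → b ∈ Nbr c (left M i)
    → b ∉ image (right M) → Matching c A B s
  redirect M i {b} b∈B left-i∼b b∉ = record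
    { left            = left M
    ; right           = updateAt (right M) i (const b)
    ; left∈A          = left∈A M
    ; right∈B         = updateAt-elim (λ _ y → y ∈ B) b∈B (λ j _ → right∈B M j)
    ; edge            = updateAt-elim (λ j y → y ∈ Nbr c (left M j)) left-i∼b (λ j _ → edge M j)
    ; left-injective  = left-injective M
    ; right-injective = updateAt-injective (right-injective M) b∉ i
    }

module Augmentation {c : Colouring N} (simple : IsSimple c) {A B : Subset N}
  (disjoint : ∀ {x} → x ∈ A → x ∉ B)
  (few-missing : ∀ {a b} → a ∈ A → b ∈ B → missing c a + missing c b < ∣ B ∣) where

  -- Counting the (all matched) neighbours of a and b yields an edge (lᵢ, rᵢ) with a ∼ rᵢ
  -- and b ∼ lᵢ; it is replaced by (lᵢ, b) and (a, rᵢ).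
  exchange : ∀ {s} (M : Matching c A B s) → s < ∣ A ∣ → ∀ {a b}
    → a ∈ A → a ∉ image (left M) → b ∈ B → b ∉ image (right M)
    → B ∩ Nbr c a ⊆ image (right M) → A ∩ Nbr c b ⊆ image (left M) → Matching c A B (suc s)
  exchange {s} M s<∣A∣ {a} {b} a∈A a∉ b∈B b∉ B∩Nbr[a]⊆ A∩Nbr[b]⊆ =
    swap (n<∣p∣+∣q∣⇒Nonempty[p∩q] (preimage (right M) (Nbr c a)) (preimage (left M) (Nbr c b)) s<k₁+k₂)
    where
    k₁ = ∣ preimage (right M) (Nbr c a) ∣
    k₂ = ∣ preimage (left M) (Nbr c b) ∣
    ∣B∣≤k₁+m[a] : ∣ B ∣ ≤ k₁ + missing c a
    ∣B∣≤k₁+m[a] = ≤-trans (∣p∣≤∣p∩Nbr∣+missing simple B (disjoint a∈A)) (+-monoˡ-≤ (missing c a)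
      (≤-trans (⊆image⇒∣p∣≤∣preimage∣ (right M) B∩Nbr[a]⊆) (p⊆q⇒∣p∣≤∣q∣ (preimage-mono (right M) (p∩q⊆q B _)))))
    ∣A∣≤k₂+m[b] : ∣ A ∣ ≤ k₂ + missing c b
    ∣A∣≤k₂+m[b] = ≤-trans (∣p∣≤∣p∩Nbr∣+missing simple A (λ b∈A → disjoint b∈A b∈B)) (+-monoˡ-≤ (missing c b)
      (≤-trans (⊆image⇒∣p∣≤∣preimage∣ (left M) A∩Nbr[b]⊆) (p⊆q⇒∣p∣≤∣q∣ (preimage-mono (left M) (p∩q⊆q A _)))))
    rearrange : ∀ k₁ k₂ m₁ m₂ → (k₂ + m₂) + (k₁ + m₁) ≡ (k₁ + k₂) + (m₁ + m₂)
    rearrange = solve-∀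
    s<k₁+k₂ : s < k₁ + k₂
    s<k₁+k₂ = +-cancelʳ-< ∣ B ∣ s (k₁ + k₂) (begin-strict
      s + ∣ B ∣                                <⟨ +-monoˡ-< ∣ B ∣ s<∣A∣ ⟩
      ∣ A ∣ + ∣ B ∣                            ≤⟨ +-mono-≤ ∣A∣≤k₂+m[b] ∣B∣≤k₁+m[a] ⟩
      (k₂ + missing c b) + (k₁ + missing c a)  ≡⟨ rearrange k₁ k₂ (missing c a) (missing c b) ⟩
      (k₁ + k₂) + (missing c a + missing c b)  <⟨ +-monoʳ-< (k₁ + k₂) (few-missing a∈A b∈B) ⟩
      (k₁ + k₂) + ∣ B ∣                        ∎)
      where open ≤-Reasoning
    swap : Nonempty (preimage (right M) (Nbr c a) ∩ preimage (left M) (Nbr c b)) → Matching c A B (suc s)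
    swap (i , i∈) with x∈p∩q⁻ _ _ i∈
    ... | a∼right-i , b∼left-i =
      add-edge (redirect M i b∈B (Nbr-sym simple (to ∈preimage b∼left-i)) b∉)
        a∈A (right∈B M i) (to ∈preimage a∼right-i) a∉ (replaced∉image (right-injective M) b∉ i)

  augment-at : ∀ {s} (M : Matching c A B s) → s < ∣ A ∣ → ∀ {a b}
    → a ∈ A → a ∉ image (left M) → b ∈ B → b ∉ image (right M) → Matching c A B (suc s)
  augment-at M s<∣A∣ {a} {b} a∈A a∉ b∈B b∉
    with nonempty? ((B ─ image (right M)) ∩ Nbr c a) | nonempty? ((A ─ image (left M)) ∩ Nbr c b)
  ... | yes (y , y∈) | _ with x∈[p─q]∩r⁻ B _ _ y∈
  ...   | y∈B , y∉ , a∼y = add-edge M a∈A y∈B a∼y a∉ y∉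
  augment-at M s<∣A∣ a∈A a∉ b∈B b∉ | no _ | yes (x , x∈) with x∈[p─q]∩r⁻ A _ _ x∈
  ...   | x∈A , x∉ , b∼x = add-edge M x∈A b∈B (Nbr-sym simple b∼x) x∉ b∉
  augment-at M s<∣A∣ a∈A a∉ b∈B b∉ | no none₁ | no none₂ =
    exchange M s<∣A∣ a∈A a∉ b∈B b∉ (Empty[[p─q]∩r]⇒p∩r⊆q B _ _ none₁) (Empty[[p─q]∩r]⇒p∩r⊆q A _ _ none₂)

  augment : ∀ {s} → Matching c A B s → s < ∣ A ∣ → s < ∣ B ∣ → Matching c A B (suc s)
  augment M s<∣A∣ s<∣B∣ with m<∣p∣⇒∃∉image (left M) A s<∣A∣ | m<∣p∣⇒∃∉image (right M) B s<∣B∣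
  ... | a , a∈A , a∉ | b , b∈B , b∉ = augment-at M s<∣A∣ a∈A a∉ b∈B b∉

  matching : ∀ s → s ≤ ∣ A ∣ → s ≤ ∣ B ∣ → Matching c A B s
  matching zero    _     _     = no-edges
  matching (suc s) s<∣A∣ s<∣B∣ = augment (matching s (<⇒≤ s<∣A∣) (<⇒≤ s<∣B∣)) s<∣A∣ s<∣B∣

edges : ∀ {c : Colouring N} {A B s} → Matching c A B s → List (Fin N × Fin N)
edges M = List.tabulate (λ i → left M i , right M i)

saturated-edges : ∀ {c : Colouring N} {A B s} (M : Matching c A B s) → saturated (edges M) ≡ 2 * s
saturated-edges M = cong (2 *_) (length-tabulate (λ i → left M i , right M i))

All-endpoints : ∀ {P : Fin n → Set} (es : List (Fin n × Fin n))
  → All (λ e → P (proj₁ e) × P (proj₂ e)) es → All P (endpoints es)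
All-endpoints []       []                = []
All-endpoints (_ ∷ es) ((Px , Py) ∷ Pes) = Px ∷ Py ∷ All-endpoints es Pes

Unique-endpoints : (f g : Fin m → Fin n) → Injective _≡_ _≡_ f → Injective _≡_ _≡_ g
  → (∀ i j → f i ≢ g j) → Unique (endpoints (List.tabulate (λ i → f i , g i)))
Unique-endpoints {zero}  f g f-inj g-inj f≢g = []
Unique-endpoints {suc m} f g f-inj g-inj f≢g =
  (f≢g zero zero ∷ fresh (f zero) (λ i → 0≢1+n ∘ f-inj) (λ i → f≢g zero (suc i)))
  ∷ fresh (g zero) (λ i → f≢g (suc i) zero ∘ sym) (λ i → 0≢1+n ∘ g-inj)
  ∷ Unique-endpoints (f ∘ suc) (g ∘ suc) (suc-injective ∘ f-inj) (suc-injective ∘ g-inj)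
      (λ i j → f≢g (suc i) (suc j))
  where
  fresh : ∀ x → (∀ i → x ≢ f (suc i)) → (∀ i → x ≢ g (suc i))
    → All (x ≢_) (endpoints (List.tabulate (λ i → f (suc i) , g (suc i))))
  fresh x x≢f x≢g = All-endpoints _ (tabulate⁺ (λ i → x≢f i , x≢g i))

edges-isMatchingIn : ∀ {c : Colouring N} {A B s k S} (M : Matching c A B s)
  → (∀ {x} → x ∈ A → x ∉ B) → (∀ i → Adj c k (left M i) (right M i)) → A ⊆ S → B ⊆ S
  → IsMatchingIn c k S (edges M)
edges-isMatchingIn {B = B} M disjoint coloured A⊆S B⊆S =
  tabulate⁺ (λ i → coloured i , A⊆S (left∈A M i) , B⊆S (right∈B M i))
  , Unique-endpoints (left M) (right M) (left-injective M) (right-injective M)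
      (λ i j lᵢ≡rⱼ → disjoint (left∈A M i) (subst (_∈ B) (sym lᵢ≡rⱼ) (right∈B M j)))

-- The third component

8m₁<n⇒8m₂<n⇒4[m₁+m₂]<n : ∀ n m₁ m₂ → 8 * m₁ < n → 8 * m₂ < n → 4 * (m₁ + m₂) < n
8m₁<n⇒8m₂<n⇒4[m₁+m₂]<n n m₁ m₂ 8m₁<n 8m₂<n = *-cancelˡ-≤ 2 (begin
  2 * suc (4 * (m₁ + m₂))      ≡⟨ identity m₁ m₂ ⟩
  suc (8 * m₁) + suc (8 * m₂)  ≤⟨ +-mono-≤ 8m₁<n 8m₂<n ⟩
  n + n                        ≡⟨ cong (n +_) (sym (+-identityʳ n)) ⟩
  2 * n                        ∎)
  where
  open ≤-Reasoning
  identity : ∀ m₁ m₂ → 2 * suc (4 * (m₁ + m₂)) ≡ suc (8 * m₁) + suc (8 * m₂)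
  identity = solve-∀

n≤2[c+d]⇒4c<n⇒n<4d : ∀ n c d → n ≤ 2 * (c + d) → 4 * c < n → n < 4 * d
n≤2[c+d]⇒4c<n⇒n<4d n c d n≤2[c+d] 4c<n = +-cancelˡ-< n n (4 * d) (begin-strict
  n + n              ≡⟨ cong (n +_) (sym (+-identityʳ n)) ⟩
  2 * n              ≤⟨ *-monoʳ-≤ 2 n≤2[c+d] ⟩
  2 * (2 * (c + d))  ≡⟨ identity c d ⟩
  4 * c + 4 * d      <⟨ +-monoˡ-< (4 * d) 4c<n ⟩
  n + 4 * d          ∎)
  where
  open ≤-Reasoning
  identity : ∀ c d → 2 * (2 * (c + d)) ≡ 4 * c + 4 * d
  identity = solve-∀

one two : Fin 3
one = suc zero
two = suc (suc zero)

module ThirdComponent {c : Colouring N} (simple : IsSimple c) (dense : DenseN/8 c)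
  (small-matchings : ∀ S M → IsComponent c two S → IsMatchingIn c two S M → 2 * saturated M < N)
  {V₁ V₂ : Subset N} (comp₁ : IsComponent c zero V₁) (comp₂ : IsComponent c one V₂)
  (half₁ : N ≤ 2 * ∣ V₁ ∣) (half₂ : N ≤ 2 * ∣ V₂ ∣) where

  A B C W : Subset N
  A = V₁ ─ V₂
  B = V₂ ─ V₁
  C = V₁ ∩ V₂
  W = ∁ (V₁ ∪ V₂)

  A∩B=∅ : ∀ {x} → x ∈ A → x ∉ B
  A∩B=∅ x∈A x∈B = proj₂ (x∈p─q⁻ V₂ V₁ x∈B) (proj₁ (x∈p─q⁻ V₁ V₂ x∈A))

  W∩V₁=∅ : ∀ {w} → w ∈ W → w ∉ V₁
  W∩V₁=∅ w∈W w∈V₁ = x∈∁p⇒x∉p w∈W (x∈p∪q⁺ (inj₁ w∈V₁))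

  W∩V₂=∅ : ∀ {w} → w ∈ W → w ∉ V₂
  W∩V₂=∅ w∈W w∈V₂ = x∈∁p⇒x∉p w∈W (x∈p∪q⁺ (inj₂ w∈V₂))

  W∩C=∅ : ∀ {w} → w ∈ W → w ∉ C
  W∩C=∅ w∈W = W∩V₁=∅ w∈W ∘ proj₁ ∘ x∈p∩q⁻ V₁ V₂

  ∣V₁∣≡∣C∣+∣A∣ : ∣ V₁ ∣ ≡ ∣ C ∣ + ∣ A ∣
  ∣V₁∣≡∣C∣+∣A∣ = ∣p∣≡∣p∩q∣+∣p─q∣ V₁ V₂

  ∣V₂∣≡∣C∣+∣B∣ : ∣ V₂ ∣ ≡ ∣ C ∣ + ∣ B ∣
  ∣V₂∣≡∣C∣+∣B∣ = trans (∣p∣≡∣p∩q∣+∣p─q∣ V₂ V₁) (cong (λ D → ∣ D ∣ + ∣ B ∣) (∩-comm V₂ V₁))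

  4[mᵤ+mᵥ]<N : ∀ u v → 4 * (missing c u + missing c v) < N
  4[mᵤ+mᵥ]<N u v = 8m₁<n⇒8m₂<n⇒4[m₁+m₂]<n N (missing c u) (missing c v) (dense u) (dense v)

  separated-edge-colour : ∀ {x y} → Separates V₁ x y → Separates V₂ x y → y ∈ Nbr c x → Adj c two x y
  separated-edge-colour sep₁ sep₂ x∼y =
    third-colour {c = c} x∼y (separated⇒¬Adj simple comp₁ sep₁) (separated⇒¬Adj simple comp₂ sep₂)

  AB-colour : ∀ {x y} → x ∈ A → y ∈ B → y ∈ Nbr c x → Adj c two x y
  AB-colour x∈A y∈B with x∈p─q⁻ V₁ V₂ x∈A | x∈p─q⁻ V₂ V₁ y∈B
  ... | x∈V₁ , x∉V₂ | y∈V₂ , y∉V₁ = separated-edge-colour (inj₁ (x∈V₁ , y∉V₁)) (inj₂ (x∉V₂ , y∈V₂))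

  WC-colour : ∀ {w z} → w ∈ W → z ∈ C → z ∈ Nbr c w → Adj c two w z
  WC-colour w∈W z∈C with x∈p∩q⁻ V₁ V₂ z∈C
  ... | z∈V₁ , z∈V₂ = separated-edge-colour (inj₂ (W∩V₁=∅ w∈W , z∈V₁)) (inj₂ (W∩V₂=∅ w∈W , z∈V₂))

  module SmallCore {u v} (small : ∣ C ∣ ≤ missing c u + missing c v) where

    4∣C∣<N : 4 * ∣ C ∣ < N
    4∣C∣<N = ≤-<-trans (*-monoʳ-≤ 4 {∣ C ∣} {missing c u + missing c v} small) (4[mᵤ+mᵥ]<N u v)

    N<4∣A∣ : N < 4 * ∣ A ∣
    N<4∣A∣ = n≤2[c+d]⇒4c<n⇒n<4d N ∣ C ∣ ∣ A ∣ (subst (λ k → N ≤ 2 * k) ∣V₁∣≡∣C∣+∣A∣ half₁) 4∣C∣<N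

    N<4∣B∣ : N < 4 * ∣ B ∣
    N<4∣B∣ = n≤2[c+d]⇒4c<n⇒n<4d N ∣ C ∣ ∣ B ∣ (subst (λ k → N ≤ 2 * k) ∣V₂∣≡∣C∣+∣B∣ half₂) 4∣C∣<N

    few-missing : ∀ (D : Subset N) → N < 4 * ∣ D ∣ → ∀ x y → missing c x + missing c y < ∣ D ∣
    few-missing D N<4∣D∣ x y = *-cancelˡ-< 4 (missing c x + missing c y) ∣ D ∣ (<-trans (4[mᵤ+mᵥ]<N x y) N<4∣D∣)

    module _ {a₀ X} (a₀∈A : a₀ ∈ A) (X-component : IsComponent c two X) (a₀∈X : a₀ ∈ X) where

      A⊆X : A ⊆ X
      A⊆X {x} x∈A = through (common-neighbour simple B (A∩B=∅ a₀∈A) (A∩B=∅ x∈A) (few-missing B N<4∣B∣ a₀ x))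
        where
        through : (∃ λ y → y ∈ B × y ∈ Nbr c a₀ × y ∈ Nbr c x) → x ∈ X
        through (y , y∈B , a₀∼y , x∼y) = component-closed X-component a₀∈X
          (AB-colour a₀∈A y∈B a₀∼y ◅ Adj-sym simple (AB-colour x∈A y∈B x∼y) ◅ ε)

      B⊆X : B ⊆ X
      B⊆X {y} y∈B = through (common-neighbour simple A y∉A y∉A (few-missing A N<4∣A∣ y y))
        where
        y∉A : y ∉ A
        y∉A y∈A = A∩B=∅ y∈A y∈B
        through : (∃ λ x → x ∈ A × x ∈ Nbr c y × x ∈ Nbr c y) → y ∈ X
        through (x , x∈A , y∼x , _) = component-closed X-component (A⊆X x∈A)
          (AB-colour x∈A y∈B (Nbr-sym simple y∼x) ◅ ε)

      s : ℕ
      s = ∣ A ∣ ⊓ ∣ B ∣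

      M : Matching c A B s
      M = Augmentation.matching simple A∩B=∅ (λ {a} {b} _ _ → few-missing B N<4∣B∣ a b) s
            (m⊓n≤m ∣ A ∣ ∣ B ∣) (m⊓n≤n ∣ A ∣ ∣ B ∣)

      4s<N : 4 * s < N
      4s<N = subst (_< N) (trans (cong (2 *_) (saturated-edges M)) (sym (*-assoc 2 2 s)))
        (small-matchings X (edges M) X-component
          (edges-isMatchingIn M A∩B=∅ (λ i → AB-colour (left∈A M i) (right∈B M i) (edge M i)) A⊆X B⊆X))

      N<4s : N < 4 * s
      N<4s = subst (N <_) (sym (*-distribˡ-⊓ 4 ∣ A ∣ ∣ B ∣)) (⊓-glb N<4∣A∣ N<4∣B∣)

    impossible : ⊥
    impossible = from-vertex (∣p∣>0⇒Nonempty A (*-cancelˡ-< 4 0 ∣ A ∣ (≤-<-trans z≤n N<4∣A∣)))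
      where
      from-component : ∀ {a₀} → a₀ ∈ A → ¬ Σ (Subset N) (λ X → IsComponent c two X × a₀ ∈ X)
      from-component a₀∈A (X , X-component , a₀∈X) =
        <-asym (4s<N a₀∈A X-component a₀∈X) (N<4s a₀∈A X-component a₀∈X)
      from-vertex : ¬ Nonempty A
      from-vertex (a₀ , a₀∈A) = from-component a₀∈A (component simple two a₀)

  core-large : ∀ u v → missing c u + missing c v < ∣ C ∣
  core-large u v with missing c u + missing c v <? ∣ C ∣
  ... | yes large = large
  ... | no ¬large = ⊥-elim (SmallCore.impossible (≮⇒≥ ¬large))

  W-connected : ∀ {w v} → w ∈ W → v ∈ W → Conn c two w v
  W-connected {w} {v} w∈W v∈W = through (common-neighbour simple C (W∩C=∅ w∈W) (W∩C=∅ v∈W) (core-large w v))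
    where
    through : (∃ λ z → z ∈ C × z ∈ Nbr c w × z ∈ Nbr c v) → Conn c two w v
    through (z , z∈C , w∼z , v∼z) = WC-colour w∈W z∈C w∼z ◅ Adj-sym simple (WC-colour v∈W z∈C v∼z) ◅ ε

  third-component : Σ (Subset N) λ V₃ → IsComponent c two V₃ × W ⊆ V₃
  third-component with nonempty? W
  ... | yes (w , w∈W) = containing w∈W (component simple two w)
    where
    containing : ∀ {w} → w ∈ W → Σ (Subset N) (λ S → IsComponent c two S × w ∈ S)
      → Σ (Subset N) λ V₃ → IsComponent c two V₃ × W ⊆ V₃
    containing w∈W (V₃ , comp₃ , w∈V₃) =
      V₃ , comp₃ , λ v∈W → component-closed comp₃ w∈V₃ (W-connected w∈W v∈W)
  ... | no W-empty = let (V₃ , comp₃ , _) = component simple two (proj₁ (proj₁ comp₁))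
                     in V₃ , comp₃ , λ {v} v∈W → contradiction (v , v∈W) W-empty

  covers : ∀ {V₃} → W ⊆ V₃ → ∀ v → v ∈ V₁ ⊎ v ∈ V₂ ⊎ v ∈ V₃
  covers W⊆V₃ v with v ∈? V₁ | v ∈? V₂
  ... | yes v∈V₁ | _        = inj₁ v∈V₁
  ... | no _     | yes v∈V₂ = inj₂ (inj₁ v∈V₂)
  ... | no v∉V₁  | no v∉V₂  = inj₂ (inj₂ (W⊆V₃ (x∉p⇒x∈∁p ([ v∉V₁ , v∉V₂ ] ∘ x∈p∪q⁻ V₁ V₂))))

lemma4p3 : (N : ℕ) (c : Colouring N) → IsSimple c → DenseN/8 c
    → (∀ (i : Fin 3) (S : Subset N) (M : List (Fin N × Fin N))
         → IsComponent c i S → IsMatchingIn c i S M → 2 * saturated M < N)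
    → (∀ (i : Fin 3) (S : Subset N) → IsComponent c i S → 4 * ∣ S ∣ < 3 * N)
    → (V₁ V₂ : Subset N)
    → IsComponent c zero V₁ → IsComponent c (suc zero) V₂
    → N ≤ 2 * ∣ V₁ ∣ → N ≤ 2 * ∣ V₂ ∣
    → Σ (Subset N) (λ V₃ → IsComponent c (suc (suc zero)) V₃
         × (∀ (v : Fin N) → v ∈ V₁ ⊎ v ∈ V₂ ⊎ v ∈ V₃))
lemma4p3 N c simple dense small-matchings _ V₁ V₂ comp₁ comp₂ half₁ half₂ =
  V₃ , comp₃ , covers W⊆V₃
  where
  open ThirdComponent simple dense (small-matchings two) comp₁ comp₂ half₁ half₂
  V₃ = proj₁ third-component
  comp₃ = proj₁ (proj₂ third-component)
  W⊆V₃ = proj₂ (proj₂ third-component)
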